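{- Let $\mathbf{L}=(\mathbf{A},G,H,F,P)$ be a $\mathrm{tDLI}^{+}_{01}$-algebra. Then the assignments $\theta\mapsto 1/\theta$ (for $\theta\in\mathsf{Con}(\mathbf{L})$) and $S\mapsto\Theta(S)=\{(a,b)\in A^2: a\to b\in S \text{ and } b\to a\in S\}$ (for $S$ a tense 1-filter of $\mathbf{L}$) determine mutually inverse bijections between $\mathsf{Con}(\mathbf{L})$ and the set of tense 1-filters of $\mathbf{L}$.
   Context: A DLI$^{+}$-algebra is $\langle A,\wedge,\vee,\to,0,1\rangle$ with bounded distributive lattice reduct such that $(a\to b)\wedge(a\to d)=a\to(b\wedge d)$, $(a\to d)\wedge(b\to d)=(a\vee b)\to d$, $0\to a=1$, $a\to 1=1$, $a\wedge(a\to b)\le b$. A tense DLI$^{+}$-algebra is $(\mathbf{A},G,H,F,P)$ with unary operations satisfying: $P(x)\le y$ iff $x\le G(y)$; $F(x)\le y$ iff $x\le H(y)$; $G(x)\wedge F(y)\le F(x\wedge y)$, $H(x)\wedge P(y)\le P(x\wedge y)$; $G(x\vee y)\le G(x)\vee F(y)$, $H(x\vee y)\le H(x)\vee P(y)$; $G(x\to y)\le G(x)\to G(y)$, $H(x\to y)\le H(x)\to H(y)$; $G(x\to y)\le F(x)\to F(y)$, $H(x\to y)\le P(x)\to P(y)$. A $\mathrm{tDLI}^{+}_{01}$-algebra is a tense DLI$^{+}$-algebra with $G(0)=0=H(0)$ and $x\to x=1$ for all $x$. A 1-filter is a lattice filter $S$ of $\mathbf{A}$ such that $((a\wedge f)\to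 b)\to(a\to b)\in S$ for all $a,b\in A$ and $f\in S$; a tense 1-filter is a 1-filter closed under $G$ and $H$. $\mathsf{Con}(\mathbf{L})$ is the set of congruences of $\mathbf{L}$ (compatible with $\wedge,\vee,\to,0,1,G,H,F,P$), and $1/\theta$ is the $\theta$-class of $1$. -}

module Defs where

open import Level using (Level; _⊔_; suc)
open import Data.Product using (_×_; _,_)
open import Relation.Binary.PropositionalEquality using (_≡_)
open import Relation.Binary.Structures using (IsEquivalence)
open import Algebra.Lattice.Structures using (IsDistributiveLattice)

record TDLI01 (a : Level) : Set (suc a) where
  infixr 6 _∨_
  infixr 7 _∧_
  infixr 5 _⇒_
  field
    Carrier : Set a
    _∧_ _∨_ _⇒_ : Carrier → Carrier → Carrier
    𝟘 𝟙 : Carrier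
    G H F P : Carrier → Carrier
    isDistributiveLattice : IsDistributiveLattice _≡_ _∨_ _∧_
    𝟘-least    : ∀ x → 𝟘 ∧ x ≡ 𝟘
    𝟙-greatest : ∀ x → x ∧ 𝟙 ≡ x

  infix 4 _≤_
  _≤_ : Carrier → Carrier → Set a
  x ≤ y = x ∧ y ≡ x

  field
    ⇒-∧ : ∀ x y z → (x ⇒ y) ∧ (x ⇒ z) ≡ x ⇒ (y ∧ z)
    ⇒-∨ : ∀ x y z → (x ⇒ z) ∧ (y ⇒ z) ≡ (x ∨ y) ⇒ z
    𝟘⇒ : ∀ x → 𝟘 ⇒ x ≡ 𝟙
    ⇒𝟙 : ∀ x → x ⇒ 𝟙 ≡ 𝟙
    mp : ∀ x y → x ∧ (x ⇒ y) ≤ y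
    P⊣G : ∀ x y → (P x ≤ y → x ≤ G y) × (x ≤ G y → P x ≤ y)
    F⊣H : ∀ x y → (F x ≤ y → x ≤ H y) × (x ≤ H y → F x ≤ y)
    GF : ∀ x y → G x ∧ F y ≤ F (x ∧ y)
    HP : ∀ x y → H x ∧ P y ≤ P (x ∧ y)
    G∨ : ∀ x y → G (x ∨ y) ≤ G x ∨ F y
    H∨ : ∀ x y → H (x ∨ y) ≤ H x ∨ P y
    G⇒ : ∀ x y → G (x ⇒ y) ≤ G x ⇒ G y
    H⇒ : ∀ x y → H (x ⇒ y) ≤ H x ⇒ H y
    G⇒F : ∀ x y → G (x ⇒ y) ≤ F x ⇒ F y
    H⇒P : ∀ x y → H (x ⇒ y) ≤ P x ⇒ P y
    G𝟘 : G 𝟘 ≡ 𝟘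
    H𝟘 : H 𝟘 ≡ 𝟘
    ⇒-refl : ∀ x → x ⇒ x ≡ 𝟙

module _ {a : Level} (L : TDLI01 a) where
  open TDLI01 L

  -- congruences of L (compatibility with the constants 0,1 is automatic by reflexivity)
  record IsCongruence {ℓ : Level} (θ : Carrier → Carrier → Set ℓ) : Set (a ⊔ ℓ) where
    field
      isEquivalence : IsEquivalence θ
      ∧-cong : ∀ {x x′ y y′} → θ x x′ → θ y y′ → θ (x ∧ y) (x′ ∧ y′)
      ∨-cong : ∀ {x x′ y y′} → θ x x′ → θ y y′ → θ (x ∨ y) (x′ ∨ y′)
      ⇒-cong : ∀ {x x′ y y′} → θ x x′ → θ y y′ → θ (x ⇒ y) (x′ ⇒ y′)
      G-cong : ∀ {x x′} → θ x x′ → θ (G x) (G x′)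
      H-cong : ∀ {x x′} → θ x x′ → θ (H x) (H x′)
      F-cong : ∀ {x x′} → θ x x′ → θ (F x) (F x′)
      P-cong : ∀ {x x′} → θ x x′ → θ (P x) (P x′)

  record IsFilter {ℓ : Level} (S : Carrier → Set ℓ) : Set (a ⊔ ℓ) where
    field
      𝟙∈ : S 𝟙
      ∧-closed : ∀ {x y} → S x → S y → S (x ∧ y)
      upward : ∀ {x y} → x ≤ y → S x → S y

  record Is1Filter {ℓ : Level} (S : Carrier → Set ℓ) : Set (a ⊔ ℓ) where
    field
      isFilter : IsFilter S
      1-cond : ∀ x y f → S f → S (((x ∧ f) ⇒ y) ⇒ (x ⇒ y))

  record IsTense1Filter {ℓ : Level} (S : Carrier → Set ℓ) : Set (a ⊔ ℓ) where
    field
      is1Filter : Is1Filter S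
      G-closed : ∀ {x} → S x → S (G x)
      H-closed : ∀ {x} → S x → S (H x)

  classOf𝟙 : {ℓ : Level} → (Carrier → Carrier → Set ℓ) → Carrier → Set ℓ
  classOf𝟙 θ x = θ x 𝟙

  Θ : {ℓ : Level} → (Carrier → Set ℓ) → Carrier → Carrier → Set ℓ
  Θ S x y = S (x ⇒ y) × S (y ⇒ x)

-- For a 1-filter S, x ⊑ y := (x ⇒ y ∈ S) is a preorder satisfying modus ponens
-- along which ∧, ∨ are monotone and ⇒ is antitone/monotone: the 1-filter condition
-- lets a hypothesis f ∈ S be discharged from an antecedent x ∧ f. Hence Θ(S), the
-- symmetric part of ⊑, is a congruence, and closure of S under G and H transports
-- ⊑ along G, H, F, P by the axioms G(x ⇒ y) ≤ G x ⇒ G y, G(x ⇒ y) ≤ F x ⇒ F y and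
-- their duals. Conversely a congruence θ is recovered from 1/θ because x ⇒ y θ 1
-- gives x θ x ∧ (x ⇒ y) = x ∧ y by modus ponens in the algebra.
module Submission where

open import Defs
open import Level using (Level)
open import Data.Product using (_×_; _,_; proj₁; map; swap)
open import Relation.Binary.PropositionalEquality as ≡ using (_≡_; cong; subst)
open import Relation.Binary.Bundles using (Setoid)
open import Algebra.Lattice.Bundles using (Lattice)
open import Algebra.Lattice.Structures using (IsDistributiveLattice)
import Algebra.Lattice.Properties.Lattice as LatticeProperties
import Relation.Binary.Lattice as OrderTheoretic
import Relation.Binary.Lattice.Properties.JoinSemilattice as JoinSemilatticeProperties
import Relation.Binary.Reasoning.Setoid as SetoidReasoning

module _ {a : Level} (L : TDLI01 a) where
  open TDLI01 L
  open IsDistributiveLattice isDistributiveLattice using (isLattice; ∧-comm; ∨-comm)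

  private
    lattice : Lattice a a
    lattice = record
      { Carrier = Carrier ; _≈_ = _≡_ ; _∨_ = _∨_ ; _∧_ = _∧_ ; isLattice = isLattice }

    -- The library orders a lattice by x ≡ x ∧ y, the symmetric form of _≤_.
    order : OrderTheoretic.Lattice a a a
    order = LatticeProperties.∨-∧-orderTheoreticLattice lattice

    module Order = OrderTheoretic.Lattice order
    open JoinSemilatticeProperties Order.joinSemilattice using (x≤y⇒x∨y≈y)

  ≤-reflexive : ∀ {x y} → x ≡ y → x ≤ y
  ≤-reflexive x≡y = ≡.sym (Order.reflexive x≡y)

  ≤-trans : ∀ {x y z} → x ≤ y → y ≤ z → x ≤ z
  ≤-trans x≤y y≤z = ≡.sym (Order.trans (≡.sym x≤y) (≡.sym y≤z))

  ≤-antisym : ∀ {x y} → x ≤ y → y ≤ x → x ≡ y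
  ≤-antisym x≤y y≤x = Order.antisym (≡.sym x≤y) (≡.sym y≤x)

  x∧y≤x : ∀ x y → x ∧ y ≤ x
  x∧y≤x x y = ≡.sym (Order.x∧y≤x x y)

  x∧y≤y : ∀ x y → x ∧ y ≤ y
  x∧y≤y x y = ≡.sym (Order.x∧y≤y x y)

  x≤x∨y : ∀ x y → x ≤ x ∨ y
  x≤x∨y x y = ≡.sym (Order.x≤x∨y x y)

  y≤x∨y : ∀ x y → y ≤ x ∨ y
  y≤x∨y x y = ≡.sym (Order.y≤x∨y x y)

  ≤⇒∨≡ : ∀ {x y} → x ≤ y → x ∨ y ≡ y
  ≤⇒∨≡ x≤y = x≤y⇒x∨y≈y (≡.sym x≤y)

  𝟙≤⇒≡𝟙 : ∀ {x} → 𝟙 ≤ x → x ≡ 𝟙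
  𝟙≤⇒≡𝟙 {x} 𝟙≤x = ≤-antisym (𝟙-greatest x) 𝟙≤x

  G𝟙 : G 𝟙 ≡ 𝟙
  G𝟙 = 𝟙≤⇒≡𝟙 (proj₁ (P⊣G 𝟙 𝟙) (𝟙-greatest (P 𝟙)))

  H𝟙 : H 𝟙 ≡ 𝟙
  H𝟙 = 𝟙≤⇒≡𝟙 (proj₁ (F⊣H 𝟙 𝟙) (𝟙-greatest (F 𝟙)))

  ⇒-monoʳ-≤ : ∀ x {y y′} → y ≤ y′ → x ⇒ y ≤ x ⇒ y′
  ⇒-monoʳ-≤ x {y} {y′} y≤y′ = ≡.trans (⇒-∧ x y y′) (cong (x ⇒_) y≤y′)

  ⇒-antimonoˡ-≤ : ∀ {x x′} y → x′ ≤ x → x ⇒ y ≤ x′ ⇒ y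
  ⇒-antimonoˡ-≤ {x} {x′} y x′≤x = begin
    (x ⇒ y) ∧ (x′ ⇒ y) ≡⟨ ∧-comm (x ⇒ y) (x′ ⇒ y) ⟩
    (x′ ⇒ y) ∧ (x ⇒ y) ≡⟨ ⇒-∨ x′ x y ⟩
    (x′ ∨ x) ⇒ y       ≡⟨ cong (_⇒ y) (≤⇒∨≡ x′≤x) ⟩
    x ⇒ y              ∎
    where
    open ≡.≡-Reasoning

  ≤⇒⇒≡𝟙 : ∀ {x y} → x ≤ y → x ⇒ y ≡ 𝟙
  ≤⇒⇒≡𝟙 {x} {y} x≤y = 𝟙≤⇒≡𝟙 (subst (_≤ x ⇒ y) (⇒-refl x) (⇒-monoʳ-≤ x x≤y))

  ⇒-cut : ∀ x y z → x ⇒ y ≤ (x ∧ (y ⇒ z)) ⇒ z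
  ⇒-cut x y z =
    ≤-trans (⇒-antimonoˡ-≤ y (x∧y≤x x f))
      (≤-trans (≤-reflexive strengthen) (⇒-monoʳ-≤ (x ∧ f) (mp y z)))
    where
    f = y ⇒ z
    open ≡.≡-Reasoning
    strengthen : (x ∧ f) ⇒ y ≡ (x ∧ f) ⇒ (y ∧ f)
    strengthen = begin
      (x ∧ f) ⇒ y                       ≡⟨ ≡.sym (𝟙-greatest _) ⟩
      ((x ∧ f) ⇒ y) ∧ 𝟙                 ≡⟨ cong (((x ∧ f) ⇒ y) ∧_) (≤⇒⇒≡𝟙 (x∧y≤y x f)) ⟨
      ((x ∧ f) ⇒ y) ∧ ((x ∧ f) ⇒ f)     ≡⟨ ⇒-∧ (x ∧ f) y f ⟩
      (x ∧ f) ⇒ (y ∧ f)                 ∎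

  module Entailment {ℓ : Level} {S : Carrier → Set ℓ} (S-is1Filter : Is1Filter L S) where
    open Is1Filter S-is1Filter
    open IsFilter isFilter

    infix 4 _⊑_
    _⊑_ : Carrier → Carrier → Set ℓ
    x ⊑ y = S (x ⇒ y)

    ∈-mp : ∀ {x y} → S x → x ⊑ y → S y
    ∈-mp {x} {y} x∈S x⊑y = upward (mp x y) (∧-closed x∈S x⊑y)

    ≤⇒⊑ : ∀ {x y} → x ≤ y → x ⊑ y
    ≤⇒⊑ x≤y = subst S (≡.sym (≤⇒⇒≡𝟙 x≤y)) 𝟙∈

    ⊑-refl : ∀ {x} → x ⊑ x
    ⊑-refl {x} = ≤⇒⊑ (≤-reflexive ≡.refl)

    ⊑-trans : ∀ {x y z} → x ⊑ y → y ⊑ z → x ⊑ z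
    ⊑-trans {x} {y} {z} x⊑y y⊑z =
      ∈-mp (upward (⇒-antimonoˡ-≤ z (mp x y)) y⊑z) (1-cond x z (x ⇒ y) x⊑y)

    ∈⇒𝟙⊑ : ∀ {x} → S x → 𝟙 ⊑ x
    ∈⇒𝟙⊑ {x} x∈S = ∈-mp (≤⇒⊑ (x∧y≤y 𝟙 x)) (1-cond 𝟙 x x x∈S)

    ⊑-∧-greatest : ∀ {x y z} → x ⊑ y → x ⊑ z → x ⊑ y ∧ z
    ⊑-∧-greatest {x} {y} {z} x⊑y x⊑z = subst S (⇒-∧ x y z) (∧-closed x⊑y x⊑z)

    ⊑-∨-least : ∀ {x y z} → x ⊑ z → y ⊑ z → x ∨ y ⊑ z
    ⊑-∨-least {x} {y} {z} x⊑z y⊑z = subst S (⇒-∨ x y z) (∧-closed x⊑z y⊑z)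

    ∧-mono-⊑ : ∀ {x x′ y y′} → x ⊑ x′ → y ⊑ y′ → x ∧ y ⊑ x′ ∧ y′
    ∧-mono-⊑ {x} {x′} {y} {y′} x⊑x′ y⊑y′ = ⊑-∧-greatest
      (⊑-trans (≤⇒⊑ (x∧y≤x x y)) x⊑x′) (⊑-trans (≤⇒⊑ (x∧y≤y x y)) y⊑y′)

    ∨-mono-⊑ : ∀ {x x′ y y′} → x ⊑ x′ → y ⊑ y′ → x ∨ y ⊑ x′ ∨ y′
    ∨-mono-⊑ {x} {x′} {y} {y′} x⊑x′ y⊑y′ = ⊑-∨-least
      (⊑-trans x⊑x′ (≤⇒⊑ (x≤x∨y x′ y′))) (⊑-trans y⊑y′ (≤⇒⊑ (y≤x∨y x′ y′)))

    ⇒-antimonoˡ-⊑ : ∀ {x x′} y → x′ ⊑ x → x ⇒ y ⊑ x′ ⇒ y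
    ⇒-antimonoˡ-⊑ {x} {x′} y x′⊑x =
      ⊑-trans (≤⇒⊑ (⇒-antimonoˡ-≤ y (mp x′ x))) (1-cond x′ y (x′ ⇒ x) x′⊑x)

    ⇒-monoʳ-⊑ : ∀ x {y y′} → y ⊑ y′ → x ⇒ y ⊑ x ⇒ y′
    ⇒-monoʳ-⊑ x {y} {y′} y⊑y′ =
      ⊑-trans (≤⇒⊑ (⇒-cut x y y′)) (1-cond x y′ (y ⇒ y′) y⊑y′)

    ⇒-mono-⊑ : ∀ {x x′ y y′} → x′ ⊑ x → y ⊑ y′ → x ⇒ y ⊑ x′ ⇒ y′
    ⇒-mono-⊑ {x′ = x′} {y = y} x′⊑x y⊑y′ =
      ⊑-trans (⇒-antimonoˡ-⊑ y x′⊑x) (⇒-monoʳ-⊑ x′ y⊑y′)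

    classOf𝟙-Θ-inverse : ∀ x → (S x → classOf𝟙 L (Θ L S) x) × (classOf𝟙 L (Θ L S) x → S x)
    classOf𝟙-Θ-inverse x =
      (λ x∈S → ≤⇒⊑ (𝟙-greatest x) , ∈⇒𝟙⊑ x∈S) , λ (_ , 𝟙⊑x) → ∈-mp 𝟙∈ 𝟙⊑x

  module _ {ℓ : Level} {S : Carrier → Set ℓ} (S-isTense1Filter : IsTense1Filter L S) where
    open IsTense1Filter S-isTense1Filter
    open Is1Filter is1Filter using (isFilter)
    open IsFilter isFilter using (upward)
    open Entailment is1Filter

    G-mono-⊑ : ∀ {x y} → x ⊑ y → G x ⊑ G y
    G-mono-⊑ x⊑y = upward (G⇒ _ _) (G-closed x⊑y)

    H-mono-⊑ : ∀ {x y} → x ⊑ y → H x ⊑ H y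
    H-mono-⊑ x⊑y = upward (H⇒ _ _) (H-closed x⊑y)

    F-mono-⊑ : ∀ {x y} → x ⊑ y → F x ⊑ F y
    F-mono-⊑ x⊑y = upward (G⇒F _ _) (G-closed x⊑y)

    P-mono-⊑ : ∀ {x y} → x ⊑ y → P x ⊑ P y
    P-mono-⊑ x⊑y = upward (H⇒P _ _) (H-closed x⊑y)

    Θ-isCongruence : IsCongruence L (Θ L S)
    Θ-isCongruence = record
      { isEquivalence = record
        { refl  = ⊑-refl , ⊑-refl
        ; sym   = swap
        ; trans = λ (x⊑y , y⊑x) (y⊑z , z⊑y) → ⊑-trans x⊑y y⊑z , ⊑-trans z⊑y y⊑x
        }
      ; ∧-cong = λ (x⊑x′ , x′⊑x) (y⊑y′ , y′⊑y) → ∧-mono-⊑ x⊑x′ y⊑y′ , ∧-mono-⊑ x′⊑x y′⊑y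
      ; ∨-cong = λ (x⊑x′ , x′⊑x) (y⊑y′ , y′⊑y) → ∨-mono-⊑ x⊑x′ y⊑y′ , ∨-mono-⊑ x′⊑x y′⊑y
      ; ⇒-cong = λ (x⊑x′ , x′⊑x) (y⊑y′ , y′⊑y) → ⇒-mono-⊑ x′⊑x y⊑y′ , ⇒-mono-⊑ x⊑x′ y′⊑y
      ; G-cong = map G-mono-⊑ G-mono-⊑
      ; H-cong = map H-mono-⊑ H-mono-⊑
      ; F-cong = map F-mono-⊑ F-mono-⊑
      ; P-cong = map P-mono-⊑ P-mono-⊑
      }

  module _ {ℓ : Level} {θ : Carrier → Carrier → Set ℓ} (θ-isCongruence : IsCongruence L θ) where
    open IsCongruence θ-isCongruence

    private
      θ-setoid : Setoid a ℓ
      θ-setoid = record { isEquivalence = isEquivalence }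

      infix 4 _~_
      _~_ : Carrier → Carrier → Set ℓ
      _~_ = θ

    open Setoid θ-setoid using (refl; sym)
    open SetoidReasoning θ-setoid

    classOf𝟙-isTense1Filter : IsTense1Filter L (classOf𝟙 L θ)
    classOf𝟙-isTense1Filter = record
      { is1Filter = record
        { isFilter = record { 𝟙∈ = refl ; ∧-closed = ∧-closed ; upward = upward }
        ; 1-cond = 1-cond
        }
      ; G-closed = λ {x} x~𝟙 → begin G x ≈⟨ G-cong x~𝟙 ⟩ G 𝟙 ≡⟨ G𝟙 ⟩ 𝟙 ∎
      ; H-closed = λ {x} x~𝟙 → begin H x ≈⟨ H-cong x~𝟙 ⟩ H 𝟙 ≡⟨ H𝟙 ⟩ 𝟙 ∎
      }
      where
      ∧-closed : ∀ {x y} → x ~ 𝟙 → y ~ 𝟙 → x ∧ y ~ 𝟙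
      ∧-closed {x} {y} x~𝟙 y~𝟙 = begin
        x ∧ y ≈⟨ ∧-cong x~𝟙 y~𝟙 ⟩
        𝟙 ∧ 𝟙 ≡⟨ 𝟙-greatest 𝟙 ⟩
        𝟙     ∎
      upward : ∀ {x y} → x ≤ y → x ~ 𝟙 → y ~ 𝟙
      upward {x} {y} x≤y x~𝟙 = begin
        y     ≡⟨ ≤⇒∨≡ x≤y ⟨
        x ∨ y ≈⟨ ∨-cong x~𝟙 refl ⟩
        𝟙 ∨ y ≡⟨ ∨-comm 𝟙 y ⟩
        y ∨ 𝟙 ≡⟨ ≤⇒∨≡ (𝟙-greatest y) ⟩
        𝟙     ∎
      1-cond : ∀ x y f → f ~ 𝟙 → ((x ∧ f) ⇒ y) ⇒ (x ⇒ y) ~ 𝟙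
      1-cond x y f f~𝟙 = begin
        ((x ∧ f) ⇒ y) ⇒ (x ⇒ y) ≈⟨ ⇒-cong (⇒-cong (∧-cong refl f~𝟙) refl) refl ⟩
        ((x ∧ 𝟙) ⇒ y) ⇒ (x ⇒ y) ≡⟨ cong (λ z → (z ⇒ y) ⇒ (x ⇒ y)) (𝟙-greatest x) ⟩
        (x ⇒ y) ⇒ (x ⇒ y)       ≡⟨ ⇒-refl (x ⇒ y) ⟩
        𝟙                       ∎

    ⇒~𝟙 : ∀ {x y} → x ~ y → x ⇒ y ~ 𝟙
    ⇒~𝟙 {x} {y} x~y = begin
      x ⇒ y ≈⟨ ⇒-cong x~y refl ⟩
      y ⇒ y ≡⟨ ⇒-refl y ⟩
      𝟙     ∎

    ⇒~𝟙⇒~∧ : ∀ {x y} → x ⇒ y ~ 𝟙 → x ~ x ∧ y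
    ⇒~𝟙⇒~∧ {x} {y} x⇒y~𝟙 = begin
      x                   ≡⟨ 𝟙-greatest x ⟨
      x ∧ 𝟙               ≈⟨ ∧-cong refl x⇒y~𝟙 ⟨
      x ∧ (x ⇒ y)         ≡⟨ mp x y ⟨
      (x ∧ (x ⇒ y)) ∧ y   ≈⟨ ∧-cong (∧-cong refl x⇒y~𝟙) refl ⟩
      (x ∧ 𝟙) ∧ y         ≡⟨ cong (_∧ y) (𝟙-greatest x) ⟩
      x ∧ y               ∎

    Θ-classOf𝟙-inverse : ∀ x y →
      (x ~ y → Θ L (classOf𝟙 L θ) x y) × (Θ L (classOf𝟙 L θ) x y → x ~ y)
    Θ-classOf𝟙-inverse x y =
      (λ x~y → ⇒~𝟙 x~y , ⇒~𝟙 (sym x~y)) ,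
      λ (x⇒y~𝟙 , y⇒x~𝟙) → begin
        x     ≈⟨ ⇒~𝟙⇒~∧ x⇒y~𝟙 ⟩
        x ∧ y ≡⟨ ∧-comm x y ⟩
        y ∧ x ≈⟨ ⇒~𝟙⇒~∧ y⇒x~𝟙 ⟨
        y     ∎

proposition6p3 : {a ℓ : Level} (L : TDLI01 a) →
    let open TDLI01 L in
    (∀ (θ : Carrier → Carrier → Set ℓ) → IsCongruence L θ → IsTense1Filter L (classOf𝟙 L θ))
    × (∀ (S : Carrier → Set ℓ) → IsTense1Filter L S → IsCongruence L (Θ L S))
    × (∀ (θ : Carrier → Carrier → Set ℓ) → IsCongruence L θ →
         ∀ x y → (θ x y → Θ L (classOf𝟙 L θ) x y) × (Θ L (classOf𝟙 L θ) x y → θ x y))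
    × (∀ (S : Carrier → Set ℓ) → IsTense1Filter L S →
         ∀ x → (S x → classOf𝟙 L (Θ L S) x) × (classOf𝟙 L (Θ L S) x → S x))
proposition6p3 L =
    (λ θ → classOf𝟙-isTense1Filter L)
  , (λ S → Θ-isCongruence L)
  , (λ θ → Θ-classOf𝟙-inverse L)
  , (λ S S-isTense1Filter →
       Entailment.classOf𝟙-Θ-inverse L (IsTense1Filter.is1Filter S-isTense1Filter))
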